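{- Let $x,v$ be positive integers with $xv\ge2$, and let $\lambda=(x,x,\dots,x)$ with $v$ occurrences of $x$ (so $n=vx$). Then $P(\lambda)\smallsetminus\{0\}$ is isomorphic to the poset with elements \[\{(r,p): 0\le r<x,\ 0\le p<v\}\smallsetminus\{(0,0),(x-1,v-1)\}\] whose strict order relation is: $(r,p)$ is strictly below $(r',p')$ if and only if $p>p'$ and $r'>r$.
   Context: For $\lambda=(\lambda_1,\dots,\lambda_d)$ positive integers summing to $n$, $\Delta_\lambda=\mathrm{conv}(e_1,\dots,e_d,\lambda)\subset\mathbb{R}^d$ ($e_i$ standard basis vectors), with fundamental parallelepiped $\Pi_\lambda=\{\sum_{i=1}^d\gamma_i(1,e_i)+\gamma_{d+1}(1,\lambda): 0\le\gamma_i<1\}$. The poset $P(\lambda)$ is $\Pi_\lambda\cap\mathbb{Z}^{d+1}$ with $\sigma\preceq\mu$ iff $\mu-\sigma\in\Pi_\lambda\cap\mathbb{Z}^{d+1}$; $0$ denotes the origin, which lies in $P(\lambda)$.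
   Formalization: The coefficients $\gamma_i$ describing the fundamental parallelepiped $\Pi_\lambda$ are taken in ℚ rather than in ℝ. -}

module Defs where

open import Data.Nat as ℕ using (ℕ; _<_)
open import Data.Integer as ℤ using (ℤ)
open import Data.Rational as ℚ using (ℚ; 0ℚ; 1ℚ)
open import Data.Fin using (Fin; zero; suc)
open import Data.Vec using (Vec; lookup; foldr; zipWith; replicate)
open import Data.Product using (Σ; ∃; _×_)
open import Relation.Binary.PropositionalEquality using (_≡_)
open import Relation.Nullary using (¬_)

ℤ→ℚ : ℤ → ℚ
ℤ→ℚ z = z ℚ./ 1

ℕ→ℚ : ℕ → ℚ
ℕ→ℚ n = ℤ.+ n ℚ./ 1

InUnit : ℚ → Set
InUnit γ = (0ℚ ℚ.≤ γ) × (γ ℚ.< 1ℚ)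

sumℚ : ∀ {d} → Vec ℚ d → ℚ
sumℚ = foldr _ ℚ._+_ 0ℚ

-- z ∈ Π_λ ∩ ℤ^{d+1}, where coordinate 0 of z is the "homogenizing" coordinate:
-- z = Σ_i γ_i (1, e_i) + c (1, λ) with all γ_i, c ∈ [0,1).
InΠ : ∀ {d} → Vec ℕ d → Vec ℤ (ℕ.suc d) → Set
InΠ {d} lam z =
  Σ (Vec ℚ d) λ γ → Σ ℚ λ c →
    ((i : Fin d) → InUnit (lookup γ i)) × InUnit c ×
    (ℤ→ℚ (lookup z zero) ≡ sumℚ γ ℚ.+ c) ×
    ((i : Fin d) → ℤ→ℚ (lookup z (suc i)) ≡ lookup γ i ℚ.+ c ℚ.* ℕ→ℚ (lookup lam i))

origin : ∀ {d} → Vec ℤ (ℕ.suc d)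
origin = replicate _ (ℤ.+ 0)

PElem∖0 : ∀ {d} → Vec ℕ d → Vec ℤ (ℕ.suc d) → Set
PElem∖0 lam z = InΠ lam z × ¬ (z ≡ origin)

_≼[_]_ : ∀ {d} → Vec ℤ (ℕ.suc d) → Vec ℕ d → Vec ℤ (ℕ.suc d) → Set
σ ≼[ lam ] μ = InΠ lam (zipWith ℤ._-_ μ σ)

_≺[_]_ : ∀ {d} → Vec ℤ (ℕ.suc d) → Vec ℕ d → Vec ℤ (ℕ.suc d) → Set
σ ≺[ lam ] μ = (σ ≼[ lam ] μ) × ¬ (σ ≡ μ)

constPart : (x v : ℕ) → Vec ℕ v
constPart x v = replicate v x

InQ : (x v : ℕ) → ℕ × ℕ → Set
InQ x v (r Data.Product., p) =
  (r < x) × (p < v) × ¬ ((r ≡ 0) × (p ≡ 0)) × ¬ ((r ≡ x ℕ.∸ 1) × (p ≡ v ℕ.∸ 1))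

_<Q_ : ℕ × ℕ → ℕ × ℕ → Set
(r Data.Product., p) <Q (r' Data.Product., p') = (p' < p) × (r < r')

module Submission where

open import Defs
open import Data.Nat using (ℕ; suc; _≤_; _*_)
open import Data.Integer using (ℤ)
open import Data.Vec using (Vec)
open import Data.Product using (Σ; _×_)
open import Relation.Binary.PropositionalEquality using (_≡_)
open import Function.Bundles using (_⇔_)

open import Data.Nat using (zero; pred; _+_; _∸_; _<_; z≤n; s≤s; z<s)
import Data.Nat.Properties as ℕP
import Data.Nat.Tactic.RingSolver as ℕSolver
open import Data.Integer as ℤ using (+_; -[1+_]; +≤+; +<+; -<-)
import Data.Integer.Properties as ℤP
import Data.Integer.Tactic.RingSolver as ℤSolver
open import Data.Rational as ℚ using (ℚ; 1ℚ; toℚᵘ)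
import Data.Rational.Properties as ℚP
import Data.Rational.Solver as ℚSolver
open import Data.Rational.Unnormalised as ℚᵘ using (mkℚᵘ; *≡*; *≤*; *<*)
import Data.Rational.Unnormalised.Properties as ℚᵘP
import Algebra.Properties.Group ℚP.+-0-group as ℚ+
open import Data.Fin using (zero; suc)
open import Data.Vec using ([]; _∷_; lookup; replicate; zipWith)
import Data.Vec.Properties as VecP
open import Data.Product using (_,_; proj₁; proj₂)
open import Data.Sum using (inj₁; inj₂)
open import Data.Empty using (⊥-elim)
open import Relation.Nullary using (¬_)
open import Relation.Binary.PropositionalEquality
  using (_≢_; refl; sym; trans; cong; cong₂; subst; subst₂; module ≡-Reasoning)
open import Function.Bundles using (mk⇔; Equivalence)
import Function.Properties.Equivalence as Eqv
open import Function.Base using (_∘_)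
open import Data.Product.Function.NonDependent.Propositional using (_×-⇔_)

-- A point of Π_λ ∩ ℤ^{v+1} is (a, b₁, …, b_v) with a = Σ γᵢ + c and
-- bᵢ = γᵢ + c x. As bᵢ − bⱼ = γᵢ − γⱼ ∈ (−1, 1), all bᵢ equal some b and all γᵢ
-- some γ; solving the remaining 2×2 system, of determinant N = vx − 1, gives
-- c N = vb − a and γ N = xa − b. So the points are the (a, b, …, b) with both
-- of these in [0, N), and since they are linear in (a, b), σ ≼ μ iff both
-- grow from σ to μ. A nonzero point has a = v − p, b = r + 1 with (r, p) ∈ Q,
-- and then c N = vr + p and γ N = N − (xp + r) are the positions of (r, p) in
-- the lexicographic orders on [0,x)×[0,v) and on [0,v)×[0,x); for distinct
-- points, moving up in the first and down in the second means r < r′, p′ < p.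

toℚᵘ-ℤ→ℚ : ∀ k → toℚᵘ (ℤ→ℚ k) ℚᵘ.≃ mkℚᵘ k 0
toℚᵘ-ℤ→ℚ k = ℚP.toℚᵘ-fromℚᵘ (mkℚᵘ k 0)

ℤ→ℚ-homo-+ : ∀ i j → ℤ→ℚ (i ℤ.+ j) ≡ ℤ→ℚ i ℚ.+ ℤ→ℚ j
ℤ→ℚ-homo-+ i j = ℚP.toℚᵘ-injective (begin
  toℚᵘ (ℤ→ℚ (i ℤ.+ j))            ≈⟨ toℚᵘ-ℤ→ℚ (i ℤ.+ j) ⟩
  mkℚᵘ (i ℤ.+ j) 0                ≈⟨ *≡* (identity i j) ⟩
  mkℚᵘ i 0 ℚᵘ.+ mkℚᵘ j 0          ≈⟨ ℚᵘP.+-cong (toℚᵘ-ℤ→ℚ i) (toℚᵘ-ℤ→ℚ j) ⟨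
  toℚᵘ (ℤ→ℚ i) ℚᵘ.+ toℚᵘ (ℤ→ℚ j)  ≈⟨ ℚP.toℚᵘ-homo-+ (ℤ→ℚ i) (ℤ→ℚ j) ⟨
  toℚᵘ (ℤ→ℚ i ℚ.+ ℤ→ℚ j)          ∎)
  where
  open ℚᵘP.≃-Reasoning
  identity : ∀ i j → (i ℤ.+ j) ℤ.* + 1 ≡ (i ℤ.* + 1 ℤ.+ j ℤ.* + 1) ℤ.* + 1
  identity = ℤSolver.solve-∀

ℤ→ℚ-homo-* : ∀ i j → ℤ→ℚ (i ℤ.* j) ≡ ℤ→ℚ i ℚ.* ℤ→ℚ j
ℤ→ℚ-homo-* i j = ℚP.toℚᵘ-injective (begin
  toℚᵘ (ℤ→ℚ (i ℤ.* j))            ≈⟨ toℚᵘ-ℤ→ℚ (i ℤ.* j) ⟩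
  mkℚᵘ i 0 ℚᵘ.* mkℚᵘ j 0          ≈⟨ ℚᵘP.*-cong (toℚᵘ-ℤ→ℚ i) (toℚᵘ-ℤ→ℚ j) ⟨
  toℚᵘ (ℤ→ℚ i) ℚᵘ.* toℚᵘ (ℤ→ℚ j)  ≈⟨ ℚP.toℚᵘ-homo-* (ℤ→ℚ i) (ℤ→ℚ j) ⟨
  toℚᵘ (ℤ→ℚ i ℚ.* ℤ→ℚ j)          ∎)
  where open ℚᵘP.≃-Reasoning

ℤ→ℚ-homo-‿- : ∀ i → ℤ→ℚ (ℤ.- i) ≡ ℚ.- ℤ→ℚ i
ℤ→ℚ-homo-‿- i = ℚP.toℚᵘ-injective (begin
  toℚᵘ (ℤ→ℚ (ℤ.- i))              ≈⟨ toℚᵘ-ℤ→ℚ (ℤ.- i) ⟩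
  ℚᵘ.- mkℚᵘ i 0                   ≈⟨ ℚᵘP.-‿cong (toℚᵘ-ℤ→ℚ i) ⟨
  ℚᵘ.- toℚᵘ (ℤ→ℚ i)               ≈⟨ ℚP.toℚᵘ-homo‿- (ℤ→ℚ i) ⟨
  toℚᵘ (ℚ.- ℤ→ℚ i)                ∎)
  where open ℚᵘP.≃-Reasoning

ℤ→ℚ-homo-*- : ∀ i j k → ℤ→ℚ (i ℤ.* j ℤ.- k) ≡ ℤ→ℚ i ℚ.* ℤ→ℚ j ℚ.- ℤ→ℚ k
ℤ→ℚ-homo-*- i j k = begin
  ℤ→ℚ (i ℤ.* j ℤ.- k)                  ≡⟨ ℤ→ℚ-homo-+ (i ℤ.* j) (ℤ.- k) ⟩
  ℤ→ℚ (i ℤ.* j) ℚ.+ ℤ→ℚ (ℤ.- k)        ≡⟨ cong₂ ℚ._+_ (ℤ→ℚ-homo-* i j) (ℤ→ℚ-homo-‿- k) ⟩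
  ℤ→ℚ i ℚ.* ℤ→ℚ j ℚ.- ℤ→ℚ k            ∎
  where open ≡-Reasoning

ℤ→ℚ-mono-≤ : ∀ {i j} → i ℤ.≤ j → ℤ→ℚ i ℚ.≤ ℤ→ℚ j
ℤ→ℚ-mono-≤ {i} {j} i≤j = ℚP.toℚᵘ-cancel-≤
  (ℚᵘP.≤-respˡ-≃ (ℚᵘP.≃-sym (toℚᵘ-ℤ→ℚ i)) (ℚᵘP.≤-respʳ-≃ (ℚᵘP.≃-sym (toℚᵘ-ℤ→ℚ j))
    (*≤* (ℤP.*-monoʳ-≤-nonNeg (+ 1) i≤j))))

ℤ→ℚ-mono-< : ∀ {i j} → i ℤ.< j → ℤ→ℚ i ℚ.< ℤ→ℚ j
ℤ→ℚ-mono-< {i} {j} i<j = ℚP.toℚᵘ-cancel-<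
  (ℚᵘP.<-respˡ-≃ (ℚᵘP.≃-sym (toℚᵘ-ℤ→ℚ i)) (ℚᵘP.<-respʳ-≃ (ℚᵘP.≃-sym (toℚᵘ-ℤ→ℚ j))
    (*<* (ℤP.*-monoʳ-<-pos (+ 1) i<j))))

ℤ→ℚ-cancel-≤ : ∀ {i j} → ℤ→ℚ i ℚ.≤ ℤ→ℚ j → i ℤ.≤ j
ℤ→ℚ-cancel-≤ {i} {j} i≤j = ℤP.*-cancelʳ-≤-pos i j (+ 1) (ℚᵘP.drop-*≤*
  (ℚᵘP.≤-respˡ-≃ (toℚᵘ-ℤ→ℚ i) (ℚᵘP.≤-respʳ-≃ (toℚᵘ-ℤ→ℚ j) (ℚP.toℚᵘ-mono-≤ i≤j))))

ℤ→ℚ-cancel-< : ∀ {i j} → ℤ→ℚ i ℚ.< ℤ→ℚ j → i ℤ.< j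
ℤ→ℚ-cancel-< {i} {j} i<j = ℤP.*-cancelʳ-<-nonNeg (+ 1) (ℚᵘP.drop-*<*
  (ℚᵘP.<-respˡ-≃ (toℚᵘ-ℤ→ℚ i) (ℚᵘP.<-respʳ-≃ (toℚᵘ-ℤ→ℚ j) (ℚP.toℚᵘ-mono-< i<j))))

integral-unit-difference≡0 : ∀ {k p q} → InUnit p → InUnit q → ℤ→ℚ k ≡ p ℚ.- q → k ≡ + 0
integral-unit-difference≡0 {k} {p} {q} (0≤p , p<1) (0≤q , q<1) k≡p-q =
  between-±1 (ℤ→ℚ-cancel-< { -[1+ 0 ]} {k} -1<k) (ℤ→ℚ-cancel-< {k} {+ 1} k<1)
  where
  -1<k : ℚ.- 1ℚ ℚ.< ℤ→ℚ k
  -1<k = subst₂ ℚ._<_ (ℚP.+-identityˡ (ℚ.- 1ℚ)) (sym k≡p-q)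
    (ℚP.+-mono-≤-< 0≤p (ℚP.neg-antimono-< q<1))
  k<1 : ℤ→ℚ k ℚ.< 1ℚ
  k<1 = subst₂ ℚ._<_ (sym k≡p-q) (ℚP.+-identityʳ 1ℚ)
    (ℚP.+-mono-<-≤ p<1 (ℚP.neg-antimono-≤ 0≤q))
  between-±1 : ∀ {k} → -[1+ 0 ] ℤ.< k → k ℤ.< + 1 → k ≡ + 0
  between-±1 {+ zero}   _         _               = refl
  between-±1 {+ suc _}  _         (+<+ (s≤s ()))
  between-±1 { -[1+ _ ]} (-<- ()) _

sumℚ-replicate : ∀ n g → sumℚ (replicate n g) ≡ ℤ→ℚ (+ n) ℚ.* g
sumℚ-replicate zero    g = sym (ℚP.*-zeroˡ g)
sumℚ-replicate (suc n) g = begin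
  g ℚ.+ sumℚ (replicate n g)     ≡⟨ cong (g ℚ.+_) (sumℚ-replicate n g) ⟩
  g ℚ.+ ℤ→ℚ (+ n) ℚ.* g          ≡⟨ solve 2 (λ g n → g :+ n :* g := (con 1ℚ :+ n) :* g) refl g (ℤ→ℚ (+ n)) ⟩
  (1ℚ ℚ.+ ℤ→ℚ (+ n)) ℚ.* g       ≡⟨ cong (ℚ._* g) (ℤ→ℚ-homo-+ (+ 1) (+ n)) ⟨
  ℤ→ℚ (+ suc n) ℚ.* g            ∎
  where
  open ≡-Reasoning
  open ℚSolver.+-*-Solver

lookup-const⇒≡replicate : ∀ {A : Set} {n} (xs : Vec A n) y → (∀ i → lookup xs i ≡ y) → xs ≡ replicate n y
lookup-const⇒≡replicate []       y _      = refl
lookup-const⇒≡replicate (x ∷ xs) y xsᵢ≡y =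
  cong₂ _∷_ (xsᵢ≡y zero) (lookup-const⇒≡replicate xs y (λ i → xsᵢ≡y (suc i)))

pos-affine : ∀ k a b → + (k * a + b) ≡ + k ℤ.* + a ℤ.+ + b
pos-affine k a b = trans (ℤP.pos-+ (k * a) b) (cong (ℤ._+ + b) (ℤP.pos-* k a))

linear-sub : ∀ k u w u′ w′ → (u′ ℤ.- u) ℤ.* k ℤ.- (w′ ℤ.- w) ≡ (u′ ℤ.* k ℤ.- w′) ℤ.- (u ℤ.* k ℤ.- w)
linear-sub = ℤSolver.solve-∀

sub-≤⇒≥ : ∀ n {i j} → n ℤ.- i ℤ.≤ n ℤ.- j → j ℤ.≤ i
sub-≤⇒≥ n {i} {j} h = ℤP.0≤i-j⇒j≤i (subst (+ 0 ℤ.≤_) (identity n i j) (ℤP.i≤j⇒0≤j-i h))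
  where
  identity : ∀ n i j → (n ℤ.- j) ℤ.- (n ℤ.- i) ≡ i ℤ.- j
  identity = ℤSolver.solve-∀

≥⇒sub-≤ : ∀ n {i j} → j ℤ.≤ i → n ℤ.- i ℤ.≤ n ℤ.- j
≥⇒sub-≤ n j≤i = ℤP.+-monoʳ-≤ n (ℤP.neg-mono-≤ j≤i)

lex-< : ∀ k {a b c} d → b < k → a < c → k * a + b < k * c + d
lex-< k {a} {b} {c} d b<k a<c = begin-strict
  k * a + b  <⟨ ℕP.+-monoʳ-< (k * a) b<k ⟩
  k * a + k  ≡⟨ ℕP.+-comm (k * a) k ⟩
  k + k * a  ≡⟨ ℕP.*-suc k a ⟨
  k * suc a  ≤⟨ ℕP.*-monoʳ-≤ k a<c ⟩
  k * c      ≤⟨ ℕP.m≤m+n (k * c) d ⟩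
  k * c + d  ∎
  where open ℕP.≤-Reasoning

lex-≤⇒≤ : ∀ k {a b c d} → d < k → k * a + b ≤ k * c + d → a ≤ c
lex-≤⇒≤ k {a} {b} d<k h = ℕP.≮⇒≥ (λ c<a → ℕP.<⇒≱ (lex-< k b d<k c<a) h)

module Constant (x′ m : ℕ) where

  x v N : ℕ
  x = suc x′
  v = suc m
  N = v * x′ + m

  lam : Vec ℕ v
  lam = constPart x v

  S T : ℕ → ℕ → ℕ
  S r p = v * r + p
  T r p = x * p + r

  2≤xv⇒0<N : 2 ≤ x * v → 0 < N
  2≤xv⇒0<N 2≤xv = subst (0 <_) (identity x′ m) (ℕP.∸-monoˡ-≤ 1 2≤xv)
    where
    identity : ∀ a b → b + a * suc b ≡ suc b * a + b
    identity = ℕSolver.solve-∀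

  T-max : T x′ m ≡ N
  T-max = identity x′ m
    where
    identity : ∀ a b → suc a * b + a ≡ suc b * a + b
    identity = ℕSolver.solve-∀

  InQ⇒S<N : ∀ {r p} → InQ x v (r , p) → S r p < N
  InQ⇒S<N {r} {p} (r<x , p<v , _ , not-last) with ℕP.m≤n⇒m<n∨m≡n (ℕP.≤-pred r<x)
  ... | inj₁ r<x′ = lex-< v m p<v r<x′
  ... | inj₂ refl = ℕP.+-monoʳ-< (v * x′) (ℕP.≤∧≢⇒< (ℕP.≤-pred p<v) (λ p≡m → not-last (refl , p≡m)))

  InQ⇒0<T : ∀ {r p} → InQ x v (r , p) → 0 < T r p
  InQ⇒0<T {zero}  {zero}  (_ , _ , not-origin , _) = ⊥-elim (not-origin (refl , refl))
  InQ⇒0<T {zero}  {suc p} _ = z<s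
  InQ⇒0<T {suc r} {p}     _ = ℕP.<-≤-trans z<s (ℕP.m≤n+m (suc r) (x * p))

  T≤N : ∀ {r p} → r < x → p < v → T r p ≤ N
  T≤N {r} {p} r<x p<v =
    subst (T r p ≤_) T-max (ℕP.+-mono-≤ (ℕP.*-monoʳ-≤ x (ℕP.≤-pred p<v)) (ℕP.≤-pred r<x))

  InQ-intro : ∀ {r p} → r < x → p < v → S r p < N → 0 < T r p → InQ x v (r , p)
  InQ-intro {r} {p} r<x p<v S<N 0<T = r<x , p<v , not-origin , not-last
    where
    not-origin : ¬ (r ≡ 0 × p ≡ 0)
    not-origin (refl , refl) = ℕP.<-irrefl (sym (trans (ℕP.+-identityʳ (x * 0)) (ℕP.*-zeroʳ x))) 0<T
    not-last : ¬ (r ≡ x′ × p ≡ m)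
    not-last (refl , refl) = ℕP.<-irrefl refl S<N

  lex-order : ∀ {r p r′ p′} → r < x → p < v → r′ < x → p′ < v →
    ((S r p ≤ S r′ p′ × T r′ p′ ≤ T r p) × (r , p) ≢ (r′ , p′)) ⇔ ((r , p) <Q (r′ , p′))
  lex-order {r} {p} {r′} {p′} r<x p<v r′<x p′<v = mk⇔ to from
    where
    to : (S r p ≤ S r′ p′ × T r′ p′ ≤ T r p) × (r , p) ≢ (r′ , p′) → (r , p) <Q (r′ , p′)
    to ((S≤S′ , T′≤T) , distinct) = p′<p , r<r′
      where
      p′≤p : p′ ≤ p
      p′≤p = lex-≤⇒≤ x r<x T′≤T
      r<r′ : r < r′
      r<r′ = ℕP.≤∧≢⇒< (lex-≤⇒≤ v p′<v S≤S′) λ { refl →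
        distinct (cong (r ,_) (ℕP.≤-antisym (ℕP.+-cancelˡ-≤ (v * r) p p′ S≤S′) p′≤p)) }
      p′<p : p′ < p
      p′<p = ℕP.≤∧≢⇒< p′≤p λ { refl → ℕP.<⇒≱ r<r′ (ℕP.+-cancelˡ-≤ (x * p′) r′ r T′≤T) }
    from : (r , p) <Q (r′ , p′) → (S r p ≤ S r′ p′ × T r′ p′ ≤ T r p) × (r , p) ≢ (r′ , p′)
    from (p′<p , r<r′) =
      (ℕP.<⇒≤ (lex-< v p′ p<v r<r′) , ℕP.<⇒≤ (lex-< x r r′<x p′<p)) ,
      λ eq → ℕP.<-irrefl (cong proj₁ eq) r<r′

  c·N γ·N : ℤ → ℤ → ℤ
  c·N a b = b ℤ.* + v ℤ.- a
  γ·N a b = a ℤ.* + x ℤ.- b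

  InRange : ℤ → Set
  InRange k = + 0 ℤ.≤ k × k ℤ.< + N

  record InBox (a b : ℤ) : Set where
    constructor inBox
    field
      c-range : InRange (c·N a b)
      γ-range : InRange (γ·N a b)

  +N≡vx-1 : + N ≡ + v ℤ.* + x ℤ.- + 1
  +N≡vx-1 = trans (pos-affine v x′ m) (identity (+ x′) (+ m))
    where
    identity : ∀ a b → (+ 1 ℤ.+ b) ℤ.* a ℤ.+ b ≡ (+ 1 ℤ.+ b) ℤ.* (+ 1 ℤ.+ a) ℤ.- + 1
    identity = ℤSolver.solve-∀

  cramer-a : ∀ a b → + N ℤ.* a ≡ + v ℤ.* γ·N a b ℤ.+ c·N a b
  cramer-a a b = trans (cong (ℤ._* a) +N≡vx-1) (identity (+ v) (+ x) a b)
    where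
    identity : ∀ v x a b → (v ℤ.* x ℤ.- + 1) ℤ.* a ≡ v ℤ.* (a ℤ.* x ℤ.- b) ℤ.+ (b ℤ.* v ℤ.- a)
    identity = ℤSolver.solve-∀

  cramer-b : ∀ a b → + N ℤ.* b ≡ + x ℤ.* c·N a b ℤ.+ γ·N a b
  cramer-b a b = trans (cong (ℤ._* b) +N≡vx-1) (identity (+ v) (+ x) a b)
    where
    identity : ∀ v x a b → (v ℤ.* x ℤ.- + 1) ℤ.* b ≡ x ℤ.* (b ℤ.* v ℤ.- a) ℤ.+ (a ℤ.* x ℤ.- b)
    identity = ℤSolver.solve-∀

  InRange-diff : ∀ {i j} → InRange i → InRange j → InRange (j ℤ.- i) ⇔ i ℤ.≤ j
  InRange-diff {+ i} {j} _ (_ , j<N) = mk⇔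
    (λ (0≤j-i , _) → ℤP.0≤i-j⇒j≤i 0≤j-i)
    (λ i≤j → ℤP.i≤j⇒0≤j-i i≤j , ℤP.≤-<-trans (ℤP.i≤j⇒i-k≤j (+ i) ℤP.≤-refl) j<N)

  InRange-N- : ∀ t → InRange (+ N ℤ.- + t) ⇔ (0 < t × t ≤ N)
  InRange-N- t = mk⇔ to from
    where
    to : InRange (+ N ℤ.- + t) → 0 < t × t ≤ N
    to (0≤N-t , N-t<N) =
      ℕP.n≢0⇒n>0 (λ { refl → ℤP.<-irrefl (ℤP.+-identityʳ (+ N)) N-t<N }) ,
      ℤP.drop‿+≤+ (ℤP.0≤i-j⇒j≤i 0≤N-t)
    from : 0 < t × t ≤ N → InRange (+ N ℤ.- + t)
    from (0<t , t≤N) = subst InRange (sym N-t≡N∸t) (+≤+ z≤n , +<+ (ℕP.∸-monoʳ-< 0<t t≤N))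
      where
      N-t≡N∸t : + N ℤ.- + t ≡ + (N ∸ t)
      N-t≡N∸t = trans (ℤP.m-n≡m⊖n N t) (ℤP.⊖-≥ t≤N)

  fromQ : ℕ × ℕ → Vec ℤ (suc v)
  fromQ (r , p) = + (v ∸ p) ∷ replicate v (+ suc r)

  toQ : Vec ℤ (suc v) → ℕ × ℕ
  toQ (a ∷ b ∷ _) = pred ℤ.∣ b ∣ , v ∸ ℤ.∣ a ∣

  toQ-fromQ : ∀ {q} → InQ x v q → toQ (fromQ q) ≡ q
  toQ-fromQ {r , p} (_ , p<v , _) = cong (r ,_) (ℕP.m∸[m∸n]≡n (ℕP.<⇒≤ p<v))

  fromQ-injective : ∀ {q q′} → InQ x v q → InQ x v q′ → fromQ q ≡ fromQ q′ → q ≡ q′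
  fromQ-injective q∈Q q′∈Q fromQ≡ = trans (sym (toQ-fromQ q∈Q)) (trans (cong toQ fromQ≡) (toQ-fromQ q′∈Q))

  v-p≡v∸p : ∀ {p} → p ≤ v → + v ℤ.- + p ≡ + (v ∸ p)
  v-p≡v∸p {p} p≤v = trans (ℤP.m-n≡m⊖n v p) (ℤP.⊖-≥ p≤v)

  c·N-fromQ : ∀ r {p} → p ≤ v → c·N (+ (v ∸ p)) (+ suc r) ≡ + S r p
  c·N-fromQ r {p} p≤v = begin
    + suc r ℤ.* + v ℤ.- + (v ∸ p)              ≡⟨ cong (λ a → + suc r ℤ.* + v ℤ.- a) (v-p≡v∸p p≤v) ⟨
    (+ 1 ℤ.+ + r) ℤ.* + v ℤ.- (+ v ℤ.- + p)    ≡⟨ identity (+ v) (+ r) (+ p) ⟩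
    + v ℤ.* + r ℤ.+ + p                         ≡⟨ pos-affine v r p ⟨
    + S r p                                     ∎
    where
    open ≡-Reasoning
    identity : ∀ v r p → (+ 1 ℤ.+ r) ℤ.* v ℤ.- (v ℤ.- p) ≡ v ℤ.* r ℤ.+ p
    identity = ℤSolver.solve-∀

  γ·N-fromQ : ∀ r {p} → p ≤ v → γ·N (+ (v ∸ p)) (+ suc r) ≡ + N ℤ.- + T r p
  γ·N-fromQ r {p} p≤v = begin
    + (v ∸ p) ℤ.* + x ℤ.- + suc r                        ≡⟨ cong (λ a → a ℤ.* + x ℤ.- + suc r) (v-p≡v∸p p≤v) ⟨
    (+ v ℤ.- + p) ℤ.* + x ℤ.- (+ 1 ℤ.+ + r)               ≡⟨ identity (+ v) (+ x) (+ p) (+ r) ⟩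
    (+ v ℤ.* + x ℤ.- + 1) ℤ.- (+ x ℤ.* + p ℤ.+ + r)       ≡⟨ cong₂ ℤ._-_ +N≡vx-1 (pos-affine x p r) ⟨
    + N ℤ.- + T r p                                       ∎
    where
    open ≡-Reasoning
    identity : ∀ v x p r → (v ℤ.- p) ℤ.* x ℤ.- (+ 1 ℤ.+ r) ≡ (v ℤ.* x ℤ.- + 1) ℤ.- (x ℤ.* p ℤ.+ r)
    identity = ℤSolver.solve-∀

  fromQ∈InBox : ∀ {r p} → InQ x v (r , p) → InBox (+ (v ∸ p)) (+ suc r)
  fromQ∈InBox {r} {p} q∈Q@(r<x , p<v , _) = inBox
    (subst InRange (sym (c·N-fromQ r p≤v)) (+≤+ z≤n , +<+ (InQ⇒S<N q∈Q)))
    (subst InRange (sym (γ·N-fromQ r p≤v)) (Equivalence.from (InRange-N- (T r p)) (InQ⇒0<T q∈Q , T≤N r<x p<v)))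
    where
    p≤v = ℕP.<⇒≤ p<v

  InBox⇒InQ : ∀ {r p} → r < x → p < v → InBox (+ (v ∸ p)) (+ suc r) → InQ x v (r , p)
  InBox⇒InQ {r} {p} r<x p<v (inBox c-range γ-range) =
    InQ-intro r<x p<v
      (ℤP.drop‿+<+ (subst (ℤ._< + N) (c·N-fromQ r p≤v) (proj₂ c-range)))
      (proj₁ (Equivalence.to (InRange-N- (T r p)) (subst InRange (γ·N-fromQ r p≤v) γ-range)))
    where
    p≤v = ℕP.<⇒≤ p<v

  coordinates-≤⇔ : ∀ {r p r′ p′} → p ≤ v → p′ ≤ v →
    (  c·N (+ (v ∸ p)) (+ suc r) ℤ.≤ c·N (+ (v ∸ p′)) (+ suc r′)
     × γ·N (+ (v ∸ p)) (+ suc r) ℤ.≤ γ·N (+ (v ∸ p′)) (+ suc r′))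
      ⇔ (S r p ≤ S r′ p′ × T r′ p′ ≤ T r p)
  coordinates-≤⇔ {r} {p} {r′} {p′} p≤v p′≤v = mk⇔
    (λ (c≤c′ , γ≤γ′) →
      ℤP.drop‿+≤+ (subst₂ ℤ._≤_ (c·N-fromQ r p≤v) (c·N-fromQ r′ p′≤v) c≤c′) ,
      ℤP.drop‿+≤+ (sub-≤⇒≥ (+ N) (subst₂ ℤ._≤_ (γ·N-fromQ r p≤v) (γ·N-fromQ r′ p′≤v) γ≤γ′)))
    (λ (S≤S′ , T′≤T) →
      subst₂ ℤ._≤_ (sym (c·N-fromQ r p≤v)) (sym (c·N-fromQ r′ p′≤v)) (+≤+ S≤S′) ,
      subst₂ ℤ._≤_ (sym (γ·N-fromQ r p≤v)) (sym (γ·N-fromQ r′ p′≤v)) (≥⇒sub-≤ (+ N) (+≤+ T′≤T)))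

  module Nondegenerate (0<N : 0 < N) where

    instance
      +N-positive : ℤ.Positive (+ N)
      +N-positive = ℤ.positive (+<+ 0<N)

    quotient-bounds : ∀ k {q i j} → + N ℤ.* q ≡ + k ℤ.* i ℤ.+ j → InRange i → InRange j →
      + 0 ℤ.≤ q × q ℤ.< + suc k
    quotient-bounds k {q} {+ i} {+ j} Nq≡ki+j (_ , +<+ i<N) (_ , +<+ j<N) =
      ℤP.*-cancelˡ-≤-pos (+ 0) q (+ N) (subst₂ ℤ._≤_ (sym (ℤP.*-zeroʳ (+ N))) (sym Nq≡) (+≤+ z≤n)) ,
      ℤP.*-cancelˡ-<-nonNeg (+ N) (subst₂ ℤ._<_ (sym Nq≡) (ℤP.pos-* N (suc k)) (+<+ ki+j<N[k+1]))
      where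
      Nq≡ : + N ℤ.* q ≡ + (k * i + j)
      Nq≡ = trans Nq≡ki+j (sym (pos-affine k i j))
      ki+j<N[k+1] : k * i + j < N * suc k
      ki+j<N[k+1] = subst (k * i + j <_) (identity k N)
        (ℕP.+-mono-≤-< (ℕP.*-monoʳ-≤ k (ℕP.<⇒≤ i<N)) j<N)
        where
        identity : ∀ k n → k * n + n ≡ n * suc k
        identity = ℕSolver.solve-∀

    InBox⇒fromQ : ∀ {a b} → InBox a b → ¬ (a ≡ + 0 × b ≡ + 0) →
      Σ ℕ λ r → Σ ℕ λ p → r < x × p < v × a ≡ + (v ∸ p) × b ≡ + suc r
    InBox⇒fromQ {a} {b} box@(inBox c-range γ-range) nonzero =
      coordinates box nonzero
        (quotient-bounds v (cramer-a a b) γ-range c-range)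
        (quotient-bounds x (cramer-b a b) c-range γ-range)
      where
      coordinates : ∀ {a b} → InBox a b → ¬ (a ≡ + 0 × b ≡ + 0) →
        + 0 ℤ.≤ a × a ℤ.< + suc v → + 0 ℤ.≤ b × b ℤ.< + suc x →
        Σ ℕ λ r → Σ ℕ λ p → r < x × p < v × a ≡ + (v ∸ p) × b ≡ + suc r
      coordinates {+ zero}    {+ zero}    _                 nonzero _ _ = ⊥-elim (nonzero (refl , refl))
      -- b = 0 makes c·N a b = −a, and a = 0 makes γ·N a b = −b.
      coordinates {+ suc _}   {+ zero}    (inBox (() , _) _) _       _ _
      coordinates {+ zero}    {+ suc _}   (inBox _ (() , _)) _       _ _
      coordinates {+ suc A}   {+ suc r}   _ _ (_ , +<+ A<v) (_ , +<+ r<x) =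
        r , v ∸ suc A , ℕP.≤-pred r<x , ℕP.∸-monoʳ-< z<s A≤v ,
        cong +_ (sym (ℕP.m∸[m∸n]≡n A≤v)) , refl
        where
        A≤v = ℕP.≤-pred A<v
      coordinates { -[1+ _ ]}  {_}         _ _ (() , _) _
      coordinates {+ _}       { -[1+ _ ]}  _ _ _ (() , _)

    Nℚ : ℚ
    Nℚ = ℤ→ℚ (+ N)

    instance
      Nℚ-positive : ℚ.Positive Nℚ
      Nℚ-positive = ℚ.positive (ℤ→ℚ-mono-< (+<+ 0<N))
      Nℚ-nonZero : ℚ.NonZero Nℚ
      Nℚ-nonZero = ℚP.pos⇒nonZero Nℚ
      Nℚ-nonNegative : ℚ.NonNegative Nℚ
      Nℚ-nonNegative = ℚP.pos⇒nonNeg Nℚ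

    Nℚ≡vx-1 : Nℚ ≡ ℤ→ℚ (+ v) ℚ.* ℤ→ℚ (+ x) ℚ.- 1ℚ
    Nℚ≡vx-1 = trans (cong ℤ→ℚ +N≡vx-1) (ℤ→ℚ-homo-*- (+ v) (+ x) (+ 1))

    _÷N : ℤ → ℚ
    k ÷N = ℤ→ℚ k ℚ.* ℚ.1/ Nℚ

    ÷N-*N : ∀ k → (k ÷N) ℚ.* Nℚ ≡ ℤ→ℚ k
    ÷N-*N k = begin
      ℤ→ℚ k ℚ.* ℚ.1/ Nℚ ℚ.* Nℚ        ≡⟨ ℚP.*-assoc (ℤ→ℚ k) (ℚ.1/ Nℚ) Nℚ ⟩
      ℤ→ℚ k ℚ.* (ℚ.1/ Nℚ ℚ.* Nℚ)      ≡⟨ cong (ℤ→ℚ k ℚ.*_) (ℚP.*-inverseˡ Nℚ) ⟩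
      ℤ→ℚ k ℚ.* 1ℚ                  ≡⟨ ℚP.*-identityʳ (ℤ→ℚ k) ⟩
      ℤ→ℚ k                         ∎
      where open ≡-Reasoning

    N*-÷N : ∀ k → (+ N ℤ.* k) ÷N ≡ ℤ→ℚ k
    N*-÷N k = begin
      ℤ→ℚ (+ N ℤ.* k) ℚ.* ℚ.1/ Nℚ    ≡⟨ cong (ℚ._* ℚ.1/ Nℚ) (ℤ→ℚ-homo-* (+ N) k) ⟩
      Nℚ ℚ.* ℤ→ℚ k ℚ.* ℚ.1/ Nℚ        ≡⟨ solve 3 (λ n k i → n :* k :* i := k :* (n :* i))
                                         refl Nℚ (ℤ→ℚ k) (ℚ.1/ Nℚ) ⟩
      ℤ→ℚ k ℚ.* (Nℚ ℚ.* ℚ.1/ Nℚ)      ≡⟨ cong (ℤ→ℚ k ℚ.*_) (ℚP.*-inverseʳ Nℚ) ⟩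
      ℤ→ℚ k ℚ.* 1ℚ                  ≡⟨ ℚP.*-identityʳ (ℤ→ℚ k) ⟩
      ℤ→ℚ k                         ∎
      where
      open ≡-Reasoning
      open ℚSolver.+-*-Solver

    ÷N-affine : ∀ k i j → (k ℤ.* i ℤ.+ j) ÷N ≡ ℤ→ℚ k ℚ.* (i ÷N) ℚ.+ j ÷N
    ÷N-affine k i j = begin
      ℤ→ℚ (k ℤ.* i ℤ.+ j) ℚ.* ℚ.1/ Nℚ
        ≡⟨ cong (ℚ._* ℚ.1/ Nℚ) (trans (ℤ→ℚ-homo-+ (k ℤ.* i) j) (cong (ℚ._+ ℤ→ℚ j) (ℤ→ℚ-homo-* k i))) ⟩
      (ℤ→ℚ k ℚ.* ℤ→ℚ i ℚ.+ ℤ→ℚ j) ℚ.* ℚ.1/ Nℚ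
        ≡⟨ solve 4 (λ k i j r → (k :* i :+ j) :* r := k :* (i :* r) :+ j :* r) refl (ℤ→ℚ k) (ℤ→ℚ i) (ℤ→ℚ j) (ℚ.1/ Nℚ) ⟩
      ℤ→ℚ k ℚ.* (i ÷N) ℚ.+ j ÷N
        ∎
      where
      open ≡-Reasoning
      open ℚSolver.+-*-Solver

    InRange⇒InUnit : ∀ {k} → InRange k → InUnit (k ÷N)
    InRange⇒InUnit {k} (0≤k , k<N) =
      ℚP.*-cancelʳ-≤-pos Nℚ (subst₂ ℚ._≤_ (sym (ℚP.*-zeroˡ Nℚ)) (sym (÷N-*N k)) (ℤ→ℚ-mono-≤ 0≤k)) ,
      ℚP.*-cancelʳ-<-nonNeg Nℚ (subst₂ ℚ._<_ (sym (÷N-*N k)) (sym (ℚP.*-identityˡ Nℚ)) (ℤ→ℚ-mono-< k<N))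

    InUnit⇒InRange : ∀ {k q} → ℤ→ℚ k ≡ q ℚ.* Nℚ → InUnit q → InRange k
    InUnit⇒InRange {k} {q} k≡q·Nℚ (0≤q , q<1) =
      ℤ→ℚ-cancel-≤ {+ 0} {k} (subst₂ ℚ._≤_ (ℚP.*-zeroˡ Nℚ) (sym k≡q·Nℚ) (ℚP.*-monoʳ-≤-nonNeg Nℚ 0≤q)) ,
      ℤ→ℚ-cancel-< {k} {+ N} (subst₂ ℚ._<_ (sym k≡q·Nℚ) (ℚP.*-identityˡ Nℚ) (ℚP.*-monoˡ-<-pos Nℚ q<1))

    InBox⇒InΠ : ∀ {a b} → InBox a b → InΠ lam (a ∷ replicate v b)
    InBox⇒InΠ {a} {b} (inBox c-range γ-range) =
      replicate v g , c ,
      (λ i → subst InUnit (sym (VecP.lookup-replicate i g)) (InRange⇒InUnit γ-range)) ,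
      InRange⇒InUnit c-range , a≡ , bᵢ≡
      where
      open ≡-Reasoning
      c g : ℚ
      c = c·N a b ÷N
      g = γ·N a b ÷N
      X = ℤ→ℚ (+ x)
      a≡ : ℤ→ℚ a ≡ sumℚ (replicate v g) ℚ.+ c
      a≡ = begin
        ℤ→ℚ a                                    ≡⟨ N*-÷N a ⟨
        (+ N ℤ.* a) ÷N                           ≡⟨ cong _÷N (cramer-a a b) ⟩
        (+ v ℤ.* γ·N a b ℤ.+ c·N a b) ÷N         ≡⟨ ÷N-affine (+ v) (γ·N a b) (c·N a b) ⟩
        ℤ→ℚ (+ v) ℚ.* g ℚ.+ c                    ≡⟨ cong (ℚ._+ c) (sumℚ-replicate v g) ⟨
        sumℚ (replicate v g) ℚ.+ c               ∎
      b≡ : ℤ→ℚ b ≡ g ℚ.+ c ℚ.* X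
      b≡ = begin
        ℤ→ℚ b                                    ≡⟨ N*-÷N b ⟨
        (+ N ℤ.* b) ÷N                           ≡⟨ cong _÷N (cramer-b a b) ⟩
        (+ x ℤ.* c·N a b ℤ.+ γ·N a b) ÷N         ≡⟨ ÷N-affine (+ x) (c·N a b) (γ·N a b) ⟩
        X ℚ.* c ℚ.+ g                            ≡⟨ ℚP.+-comm (X ℚ.* c) g ⟩
        g ℚ.+ X ℚ.* c                            ≡⟨ cong (g ℚ.+_) (ℚP.*-comm X c) ⟩
        g ℚ.+ c ℚ.* X                            ∎
      bᵢ≡ : ∀ i → ℤ→ℚ (lookup (replicate v b) i) ≡ lookup (replicate v g) i ℚ.+ c ℚ.* ℕ→ℚ (lookup lam i)
      bᵢ≡ i = begin
        ℤ→ℚ (lookup (replicate v b) i)                          ≡⟨ cong ℤ→ℚ (VecP.lookup-replicate i b) ⟩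
        ℤ→ℚ b                                                    ≡⟨ b≡ ⟩
        g ℚ.+ c ℚ.* X                                            ≡⟨ cong₂ (λ g′ y → g′ ℚ.+ c ℚ.* ℕ→ℚ y)
                                                                      (VecP.lookup-replicate i g) (VecP.lookup-replicate i x) ⟨
        lookup (replicate v g) i ℚ.+ c ℚ.* ℕ→ℚ (lookup lam i)    ∎

    InΠ⇒InBox : ∀ {a bs} → InΠ lam (a ∷ bs) → Σ ℤ λ b → bs ≡ replicate v b × InBox a b
    InΠ⇒InBox {a} {bs} (γ , c , γ-unit , c-unit , a≡ , bs≡) =
      b , lookup-const⇒≡replicate bs b bᵢ≡b ,
      inBox (InUnit⇒InRange c·N≡c·Nℚ c-unit) (InUnit⇒InRange γ·N≡g·Nℚ (γ-unit zero))
      where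
      open ≡-Reasoning
      open ℚSolver.+-*-Solver
      b = lookup bs zero
      g = lookup γ zero
      V X : ℚ
      V = ℤ→ℚ (+ v)
      X = ℤ→ℚ (+ x)
      bᵢ≡ : ∀ i → ℤ→ℚ (lookup bs i) ≡ lookup γ i ℚ.+ c ℚ.* X
      bᵢ≡ i = trans (bs≡ i) (cong (λ y → lookup γ i ℚ.+ c ℚ.* ℕ→ℚ y) (VecP.lookup-replicate i x))
      bᵢ≡b : ∀ i → lookup bs i ≡ b
      bᵢ≡b i = ℤP.i-j≡0⇒i≡j _ _ (integral-unit-difference≡0 (γ-unit i) (γ-unit zero) (begin
        ℤ→ℚ (lookup bs i ℤ.- b)                            ≡⟨ ℤ→ℚ-homo-+ (lookup bs i) (ℤ.- b) ⟩
        ℤ→ℚ (lookup bs i) ℚ.+ ℤ→ℚ (ℤ.- b)                  ≡⟨ cong (ℤ→ℚ (lookup bs i) ℚ.+_) (ℤ→ℚ-homo-‿- b) ⟩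
        ℤ→ℚ (lookup bs i) ℚ.- ℤ→ℚ b                        ≡⟨ cong₂ ℚ._-_ (bᵢ≡ i) (bᵢ≡ zero) ⟩
        (lookup γ i ℚ.+ c ℚ.* X) ℚ.- (g ℚ.+ c ℚ.* X)       ≡⟨ solve 4 (λ p q c X → (p :+ c :* X) :- (q :+ c :* X) := p :- q)
                                                              refl (lookup γ i) g c X ⟩
        lookup γ i ℚ.- g                                    ∎))
      γ≡replicate : γ ≡ replicate v g
      γ≡replicate = lookup-const⇒≡replicate γ g (λ i →
        ℚ+.∙-cancelʳ (c ℚ.* X) (lookup γ i) g (trans (sym (bᵢ≡ i)) (trans (cong ℤ→ℚ (bᵢ≡b i)) (bᵢ≡ zero))))
      a≡Vg+c : ℤ→ℚ a ≡ V ℚ.* g ℚ.+ c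
      a≡Vg+c = trans a≡ (cong (ℚ._+ c) (trans (cong sumℚ γ≡replicate) (sumℚ-replicate v g)))
      c·N≡c·Nℚ : ℤ→ℚ (c·N a b) ≡ c ℚ.* Nℚ
      c·N≡c·Nℚ = begin
        ℤ→ℚ (b ℤ.* + v ℤ.- a)                   ≡⟨ ℤ→ℚ-homo-*- b (+ v) a ⟩
        ℤ→ℚ b ℚ.* V ℚ.- ℤ→ℚ a                   ≡⟨ cong₂ (λ b a → b ℚ.* V ℚ.- a) (bᵢ≡ zero) a≡Vg+c ⟩
        (g ℚ.+ c ℚ.* X) ℚ.* V ℚ.- (V ℚ.* g ℚ.+ c) ≡⟨ solve 4 (λ g c V X → (g :+ c :* X) :* V :- (V :* g :+ c)
                                                                    := c :* (V :* X :- con 1ℚ)) refl g c V X ⟩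
        c ℚ.* (V ℚ.* X ℚ.- 1ℚ)                  ≡⟨ cong (c ℚ.*_) Nℚ≡vx-1 ⟨
        c ℚ.* Nℚ                                 ∎
      γ·N≡g·Nℚ : ℤ→ℚ (γ·N a b) ≡ g ℚ.* Nℚ
      γ·N≡g·Nℚ = begin
        ℤ→ℚ (a ℤ.* + x ℤ.- b)                   ≡⟨ ℤ→ℚ-homo-*- a (+ x) b ⟩
        ℤ→ℚ a ℚ.* X ℚ.- ℤ→ℚ b                   ≡⟨ cong₂ (λ a b → a ℚ.* X ℚ.- b) a≡Vg+c (bᵢ≡ zero) ⟩
        (V ℚ.* g ℚ.+ c) ℚ.* X ℚ.- (g ℚ.+ c ℚ.* X) ≡⟨ solve 4 (λ g c V X → (V :* g :+ c) :* X :- (g :+ c :* X)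
                                                                    := g :* (V :* X :- con 1ℚ)) refl g c V X ⟩
        g ℚ.* (V ℚ.* X ℚ.- 1ℚ)                  ≡⟨ cong (g ℚ.*_) Nℚ≡vx-1 ⟨
        g ℚ.* Nℚ                                 ∎

    InΠ⇔InBox : ∀ {a b} → InΠ lam (a ∷ replicate v b) ⇔ InBox a b
    InΠ⇔InBox {a} {b} = mk⇔
      (λ π → let (b′ , b∷bs≡b′∷bs , box) = InΠ⇒InBox π in
        subst (InBox a) (sym (VecP.∷-injectiveˡ b∷bs≡b′∷bs)) box)
      InBox⇒InΠ

    ≼⇔ : ∀ {a b a′ b′} → InBox a b → InBox a′ b′ →
      (a ∷ replicate v b) ≼[ lam ] (a′ ∷ replicate v b′) ⇔ (c·N a b ℤ.≤ c·N a′ b′ × γ·N a b ℤ.≤ γ·N a′ b′)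
    ≼⇔ {a} {b} {a′} {b′} (inBox c γ) (inBox c′ γ′) = mk⇔
      (λ z≼w → let (inBox c-range γ-range) = Equivalence.to InΠ⇔InBox (subst (InΠ lam) difference z≼w) in
        Equivalence.to (InRange-diff c c′) (subst InRange (linear-sub (+ v) b a b′ a′) c-range) ,
        Equivalence.to (InRange-diff γ γ′) (subst InRange (linear-sub (+ x) a b a′ b′) γ-range))
      (λ (c≤c′ , γ≤γ′) → subst (InΠ lam) (sym difference) (Equivalence.from InΠ⇔InBox
        (inBox (subst InRange (sym (linear-sub (+ v) b a b′ a′)) (Equivalence.from (InRange-diff c c′) c≤c′))
               (subst InRange (sym (linear-sub (+ x) a b a′ b′)) (Equivalence.from (InRange-diff γ γ′) γ≤γ′)))))
      where
      difference : zipWith ℤ._-_ (a′ ∷ replicate v b′) (a ∷ replicate v b) ≡ (a′ ℤ.- a) ∷ replicate v (b′ ℤ.- b)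
      difference = cong (a′ ℤ.- a ∷_) (VecP.zipWith-replicate ℤ._-_ b′ b)

    fromQ∈P∖0 : ∀ {q} → InQ x v q → PElem∖0 lam (fromQ q)
    fromQ∈P∖0 {r , p} q∈Q = InBox⇒InΠ (fromQ∈InBox q∈Q) , fromQ≢0
      where
      fromQ≢0 : fromQ (r , p) ≢ origin
      fromQ≢0 eq = ℕP.0≢1+n (ℤP.+-injective (sym (VecP.∷-injectiveˡ (VecP.∷-injectiveʳ eq))))

    P∖0⇒fromQ : ∀ {z} → PElem∖0 lam z → Σ (ℕ × ℕ) λ q → InQ x v q × z ≡ fromQ q
    P∖0⇒fromQ {a ∷ bs} (π , z≢0) =
      let (b , bs≡ , box) = InΠ⇒InBox π
          bs≡replicate : ∀ {b′} → b ≡ b′ → bs ≡ replicate v b′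
          bs≡replicate b≡b′ = trans bs≡ (cong (replicate v) b≡b′)
          (r , p , r<x , p<v , a≡ , b≡) = InBox⇒fromQ box (λ (a≡0 , b≡0) → z≢0 (cong₂ _∷_ a≡0 (bs≡replicate b≡0)))
      in (r , p) , InBox⇒InQ r<x p<v (subst₂ InBox a≡ b≡ box) , cong₂ _∷_ a≡ (bs≡replicate b≡)

    fromQ-≼⇔ : ∀ {r p r′ p′} → InQ x v (r , p) → InQ x v (r′ , p′) →
      fromQ (r , p) ≼[ lam ] fromQ (r′ , p′) ⇔ (S r p ≤ S r′ p′ × T r′ p′ ≤ T r p)
    fromQ-≼⇔ q∈Q@(_ , p<v , _) q′∈Q@(_ , p′<v , _) =
      Eqv.trans (≼⇔ (fromQ∈InBox q∈Q) (fromQ∈InBox q′∈Q)) (coordinates-≤⇔ (ℕP.<⇒≤ p<v) (ℕP.<⇒≤ p′<v))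

    fromQ-≺⇔ : ∀ {q q′} → InQ x v q → InQ x v q′ → (fromQ q ≺[ lam ] fromQ q′) ⇔ (q <Q q′)
    fromQ-≺⇔ {r , p} {r′ , p′} q∈Q@(r<x , p<v , _) q′∈Q@(r′<x , p′<v , _) = Eqv.trans
      (fromQ-≼⇔ q∈Q q′∈Q ×-⇔
        mk⇔ (λ z≢w → z≢w ∘ cong fromQ) (λ q≢q′ → q≢q′ ∘ fromQ-injective q∈Q q′∈Q))
      (lex-order r<x p<v r′<x p′<v)

    toQ∈Q : ∀ z → PElem∖0 lam z → InQ x v (toQ z)
    toQ∈Q z z∈P with P∖0⇒fromQ z∈P
    ... | q , q∈Q , refl = subst (InQ x v) (sym (toQ-fromQ q∈Q)) q∈Q

    toQ-injective : ∀ z w → PElem∖0 lam z → PElem∖0 lam w → toQ z ≡ toQ w → z ≡ w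
    toQ-injective z w z∈P w∈P toQ≡ with P∖0⇒fromQ z∈P | P∖0⇒fromQ w∈P
    ... | q , q∈Q , refl | q′ , q′∈Q , refl = cong fromQ (trans (sym (toQ-fromQ q∈Q)) (trans toQ≡ (toQ-fromQ q′∈Q)))

    toQ-≺⇔ : ∀ z w → PElem∖0 lam z → PElem∖0 lam w → (z ≺[ lam ] w) ⇔ (toQ z <Q toQ w)
    toQ-≺⇔ z w z∈P w∈P with P∖0⇒fromQ z∈P | P∖0⇒fromQ w∈P
    ... | q , q∈Q , refl | q′ , q′∈Q , refl =
      subst₂ (λ s t → (fromQ q ≺[ lam ] fromQ q′) ⇔ (s <Q t))
        (sym (toQ-fromQ q∈Q)) (sym (toQ-fromQ q′∈Q)) (fromQ-≺⇔ q∈Q q′∈Q)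

theorem4p1 : (x v : ℕ) → 1 ≤ x → 1 ≤ v → 2 ≤ x * v →
    Σ (Vec ℤ (suc v) → ℕ × ℕ) λ f →
      ((z : Vec ℤ (suc v)) → PElem∖0 (constPart x v) z → InQ x v (f z)) ×
      ((z w : Vec ℤ (suc v)) → PElem∖0 (constPart x v) z → PElem∖0 (constPart x v) w →
        f z ≡ f w → z ≡ w) ×
      ((q : ℕ × ℕ) → InQ x v q →
        Σ (Vec ℤ (suc v)) λ z → PElem∖0 (constPart x v) z × (f z ≡ q)) ×
      ((z w : Vec ℤ (suc v)) → PElem∖0 (constPart x v) z → PElem∖0 (constPart x v) w →
        ((z ≺[ constPart x v ] w) ⇔ (f z <Q f w)))
theorem4p1 zero     _       () _ _
theorem4p1 (suc _)  zero    _ () _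
theorem4p1 (suc x′) (suc m) _ _ 2≤xv =
  toQ , toQ∈Q , toQ-injective , (λ q q∈Q → fromQ q , fromQ∈P∖0 q∈Q , toQ-fromQ q∈Q) , toQ-≺⇔
  where
  open Constant x′ m
  open Nondegenerate (2≤xv⇒0<N 2≤xv)
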